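{- Let $M \in \Lambda$ and $\vec{x}\supseteq FV(M)$ with $|\vec{x}|=n$. If $[\![ M ]\!]^{R_A}_{\vec{x}} \neq \emptyset_{D, SD^{n}}$, then the head reduction of $M$ ends.
   Context: Here $S$ is the linear resource monad (free symmetric strict monoidal completion: lists with morphisms $\langle\alpha,f_1,\dots,f_k\rangle$ where $\alpha$ is a bijection), $A$ a small category, $D = D_A$ the colimit of $D_0=A$, $D_{n+1}=(SD_n)^{o}\times D_n\sqcup A$ (types $o\in A$ or $\langle a_1,\dots,a_k\rangle\Rightarrow a$), and $SD$ the category of lists over $D$. $[\![ M ]\!]^{R_A}_{\vec{x}} : (SD^n)^{o}\times D\to\mathrm{Set}$ is the denotation in this linear case, defined inductively by $[\![ x_i ]\!]_{\vec{x}}(\Delta,a) = SD^n(\Delta,\langle\langle\rangle,\dots,\langle a\rangle,\dots,\langle\rangle\rangle)$; $[\![ \lambda x.M ]\!]_{\vec{x}}(\Delta,\vec{a}'\Rightarrow a') = [\![ M ]\!]_{\vec{x}\oplus\langle x\rangle}(\Delta\oplus\langle\vec{a}'\rangle,a')$ and $\emptyset$ on atomic types; $[\![ MN ]\!]_{\vec{x}}(\Delta,a) = \int^{\vec{a}=\langle a_1,\dots,a_k\rangle\in SD}\int^{\Gamma_0,\dots,\Gamma_k\in SD^n}[\![ M ]\!]_{\vec{x}}(\Gamma_0,\vec{a}\Rightarrow a)\times\prod_{i=1}^k[\![ N ]\!]_{\vec{x}}(\Gamma_i,a_i)\times SD^n(\Delta,\bigotimes_{i=0}^k\Gamma_i)$.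 It is isomorphic to the distributor of congruence classes of derivations in the non-idempotent intersection type system $R_A$. The zero distributor $\emptyset_{D,SD^n}$ sends every pair to the empty set. -}

module Defs where

open import Level using (0ℓ)
open import Data.Nat using (ℕ; zero; suc)
open import Data.Fin using (Fin; zero; suc)
open import Data.List using (List; []; _∷_; length; _++_; [_])
open import Data.List.Base using (lookup)
open import Data.Vec using (Vec; []; _∷_; replicate; _[_]≔_; zipWith; foldr)
import Data.Vec as V
open import Data.Vec.Relation.Binary.Pointwise.Inductive using (Pointwise)
open import Data.Product using (Σ; Σ-syntax; _×_; _,_; ∃-syntax)
open import Data.Empty using (⊥)
open import Function.Bundles using (_⤖_; Bijection)
open import Relation.Binary.PropositionalEquality using (_≡_)
open import Relation.Nullary using (¬_)

record Category : Set₁ where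
  field
    Obj  : Set
    Hom  : Obj → Obj → Set
    idC  : ∀ {a} → Hom a a
    _∘C_ : ∀ {a b c} → Hom b c → Hom a b → Hom a c
    idˡ  : ∀ {a b} (f : Hom a b) → idC ∘C f ≡ f
    idʳ  : ∀ {a b} (f : Hom a b) → f ∘C idC ≡ f
    assoc : ∀ {a b c d} (h : Hom c d) (g : Hom b c) (f : Hom a b) →
            (h ∘C g) ∘C f ≡ h ∘C (g ∘C f)

-- Untyped λ-terms, well-scoped (Tm n = terms with FV ⊆ {x_0,…,x_{n-1}})

infixl 7 _·_
data Tm (n : ℕ) : Set where
  var : Fin n → Tm n
  ƛ_  : Tm (suc n) → Tm n
  _·_ : Tm n → Tm n → Tm n

ext : ∀ {n m} → (Fin n → Fin m) → Fin (suc n) → Fin (suc m)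
ext ρ zero    = zero
ext ρ (suc i) = suc (ρ i)

rename : ∀ {n m} → (Fin n → Fin m) → Tm n → Tm m
rename ρ (var i) = var (ρ i)
rename ρ (ƛ M)   = ƛ rename (ext ρ) M
rename ρ (M · N) = rename ρ M · rename ρ N

exts : ∀ {n m} → (Fin n → Tm m) → Fin (suc n) → Tm (suc m)
exts σ zero    = var zero
exts σ (suc i) = rename suc (σ i)

subst : ∀ {n m} → (Fin n → Tm m) → Tm n → Tm m
subst σ (var i) = σ i
subst σ (ƛ M)   = ƛ subst (exts σ) M
subst σ (M · N) = subst σ M · subst σ N

subst-zero : ∀ {n} → Tm n → Fin (suc n) → Tm n
subst-zero N zero    = N
subst-zero N (suc i) = var i

_[_]₀ : ∀ {n} → Tm (suc n) → Tm n → Tm n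
M [ N ]₀ = subst (subst-zero N) M

-- Head reduction:  λx⃗.(λy.N) P Q⃗  →h  λx⃗. N[P/y] Q⃗
infix 4 _→h_
data _→h_ {n : ℕ} : Tm n → Tm n → Set where
  β   : ∀ {M N} → (ƛ M) · N →h M [ N ]₀
  app : ∀ {M₁ M₂ M' N} → M₁ · M₂ →h M' → (M₁ · M₂) · N →h M' · N
  lam : ∀ {M M' : Tm (suc n)} → M →h M' → ƛ M →h ƛ M'

infix 4 _→h*_
data _→h*_ {n : ℕ} : Tm n → Tm n → Set where
  done : ∀ {M} → M →h* M
  step : ∀ {M M' M''} → M →h M' → M' →h* M'' → M →h* M''

HeadTerminates : ∀ {n} → Tm n → Set
HeadTerminates M = ∃[ N ] (M →h* N × (∀ N' → ¬ (N →h N')))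

-- The category D = D_A and SD (linear resource monad S)

module Model (A : Category) where
  open Category A

  data Ty : Set where
    atom : Obj → Ty
    _⇒_  : List Ty → Ty → Ty

  data DHom : Ty → Ty → Set
  data SHom (as bs : List Ty) : Set

  data DHom where
    atomH : ∀ {o o'} → Hom o o' → DHom (atom o) (atom o')
    -- D_{n+1} = (SD_n)^o × D_n ⊔ A
    arrH  : ∀ {as as' a a'} → SHom as' as → DHom a a' → DHom (as ⇒ a) (as' ⇒ a')

  data SHom as bs where
    shom : (α : Fin (length as) ⤖ Fin (length bs)) →
           ((i : Fin (length as)) → DHom (lookup as i) (lookup bs (Bijection.to α i))) →
           SHom as bs

  Ctx : ℕ → Set
  Ctx n = Vec (List Ty) n

  SDⁿ : ∀ {n} → Ctx n → Ctx n → Set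
  SDⁿ = Pointwise SHom

  _⊗_ : ∀ {n} → Ctx n → Ctx n → Ctx n
  _⊗_ = zipWith _++_

  ε : ∀ {n} → Ctx n
  ε = replicate _ []

  ⨂ : ∀ {n k} → Ctx n → Vec (Ctx n) k → Ctx n
  ⨂ Γ₀ Γs = Γ₀ ⊗ foldr _ _⊗_ ε Γs

  single : ∀ {n} → Fin n → Ty → Ctx n
  single i a = ε [ i ]≔ [ a ]

  -- Δ ⊕ ⟨a⃗'⟩ : extend the context with the (new, bound) variable;
  -- in our de Bruijn convention the new variable is position zero.
  _⊕_ : ∀ {n} → Ctx n → List Ty → Ctx (suc n)
  Δ ⊕ as = as ∷ Δ

  -- ⟦ M ⟧_x⃗ (Δ , a) : carrier sets, before taking the coend quotient
  -- (elements of ∫^… are equivalence classes of elements of these Σ-sets).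
  ⟦_⟧ : ∀ {n} → Tm n → Ctx n → Ty → Set
  ⟦ var i ⟧ Δ a          = SDⁿ Δ (single i a)
  ⟦ ƛ M ⟧ Δ (atom o)     = ⊥
  ⟦ ƛ M ⟧ Δ (as ⇒ a)     = ⟦ M ⟧ (Δ ⊕ as) a
  ⟦_⟧ {n} (M · N) Δ a    =
    Σ[ as ∈ List Ty ] Σ[ Γ₀ ∈ Ctx n ] Σ[ Γs ∈ Vec (Ctx n) (length as) ]
      (⟦ M ⟧ Γ₀ (as ⇒ a)
       × ((i : Fin (length as)) → ⟦ N ⟧ (V.lookup Γs i) (lookup as i))
       × SDⁿ Δ (⨂ Γ₀ Γs))

  -- ⟦ M ⟧ ≠ ∅_{D,SD^n}: some component of the distributor is nonempty
  -- (a coend is nonempty iff its underlying Σ-set is inhabited).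
  NonEmpty : ∀ {n} → Tm n → Set
  NonEmpty {n} M = Σ[ Δ ∈ Ctx n ] Σ[ a ∈ Ty ] ⟦ M ⟧ Δ a

module Submission where

-- The proof is a realizability (reducibility) argument.  Every type a of D
-- is interpreted as a Kripke-style set of terms ⟪ a ⟫: head-normalising
-- terms which, at an arrow type ⟨a₁,…,a_k⟩ ⇒ a, send any argument realizing
-- every aᵢ to a realizer of a.
-- The theorem follows by applying adequacy to the identity substitution,
-- which realizes every context since variables are neutral.

open import Defs
open import Data.Nat using (ℕ; suc)
open import Data.Fin using (Fin; zero; suc)
open import Data.List using (List; []; _∷_; length; _++_; [_])
open import Data.List.Base using (lookup)
open import Data.Vec using (Vec; _∷_; foldr)
import Data.Vec as V
open import Data.Vec.Properties using (lookup∘update; lookup-zipWith)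
import Data.Vec.Relation.Binary.Pointwise.Inductive as Pointwise
open import Data.Product using (Σ-syntax; _×_; _,_; proj₁; proj₂)
open import Data.Unit using (⊤; tt)
open import Function.Base using (id; _∘_)
open import Function.Bundles using (Bijection)
open import Relation.Binary.PropositionalEquality
  using (_≡_; refl; sym; trans; cong; cong₂; module ≡-Reasoning)
  renaming (subst to transport)
open import Relation.Nullary using (¬_)

private
  variable
    n m k : ℕ

exts-cong : {σ σ' : Fin n → Tm m} → (∀ x → σ x ≡ σ' x) → ∀ x → exts σ x ≡ exts σ' x
exts-cong e zero    = refl
exts-cong e (suc x) = cong (rename suc) (e x)

subst-cong : {σ σ' : Fin n → Tm m} → (∀ x → σ x ≡ σ' x) → ∀ M → subst σ M ≡ subst σ' M
subst-cong e (var x) = e x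
subst-cong e (ƛ M)   = cong ƛ_ (subst-cong (exts-cong e) M)
subst-cong e (M · N) = cong₂ _·_ (subst-cong e M) (subst-cong e N)

rename-as-subst : (ρ : Fin n → Fin m) (M : Tm n) → rename ρ M ≡ subst (var ∘ ρ) M
rename-as-subst ρ (var x) = refl
rename-as-subst ρ (ƛ M)   =
  cong ƛ_ (trans (rename-as-subst (ext ρ) M)
                 (subst-cong (λ { zero → refl ; (suc x) → refl }) M))
rename-as-subst ρ (M · N) = cong₂ _·_ (rename-as-subst ρ M) (rename-as-subst ρ N)

subst-var : (M : Tm n) → subst var M ≡ M
subst-var (var x) = refl
subst-var (ƛ M)   = cong ƛ_ (trans (subst-cong (λ { zero → refl ; (suc x) → refl }) M)
                                    (subst-var M))
subst-var (M · N) = cong₂ _·_ (subst-var M) (subst-var N)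

rename-id : (M : Tm n) → rename id M ≡ M
rename-id M = trans (rename-as-subst id M) (subst-var M)

subst-rename : (σ : Fin m → Tm k) (ρ : Fin n → Fin m) (M : Tm n) →
               subst σ (rename ρ M) ≡ subst (σ ∘ ρ) M
subst-rename σ ρ (var x) = refl
subst-rename σ ρ (ƛ M)   =
  cong ƛ_ (trans (subst-rename (exts σ) (ext ρ) M)
                 (subst-cong (λ { zero → refl ; (suc x) → refl }) M))
subst-rename σ ρ (M · N) = cong₂ _·_ (subst-rename σ ρ M) (subst-rename σ ρ N)

rename-rename : (ρ₂ : Fin m → Fin k) (ρ₁ : Fin n → Fin m) (M : Tm n) →
                rename ρ₂ (rename ρ₁ M) ≡ rename (ρ₂ ∘ ρ₁) M
rename-rename ρ₂ ρ₁ M = begin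
  rename ρ₂ (rename ρ₁ M)        ≡⟨ rename-as-subst ρ₂ (rename ρ₁ M) ⟩
  subst (var ∘ ρ₂) (rename ρ₁ M) ≡⟨ subst-rename (var ∘ ρ₂) ρ₁ M ⟩
  subst (var ∘ ρ₂ ∘ ρ₁) M        ≡⟨ sym (rename-as-subst (ρ₂ ∘ ρ₁) M) ⟩
  rename (ρ₂ ∘ ρ₁) M             ∎
  where open ≡-Reasoning

rename-subst : (ρ : Fin m → Fin k) (σ : Fin n → Tm m) (M : Tm n) →
               rename ρ (subst σ M) ≡ subst (rename ρ ∘ σ) M
rename-subst ρ σ (var x) = refl
rename-subst ρ σ (ƛ M)   =
  cong ƛ_ (trans (rename-subst (ext ρ) (exts σ) M) (subst-cong exts-commute M))
  where
  exts-commute : ∀ x → rename (ext ρ) (exts σ x) ≡ exts (rename ρ ∘ σ) x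
  exts-commute zero    = refl
  exts-commute (suc x) = trans (rename-rename (ext ρ) suc (σ x))
                               (sym (rename-rename suc ρ (σ x)))
rename-subst ρ σ (M · N) = cong₂ _·_ (rename-subst ρ σ M) (rename-subst ρ σ N)

subst-subst : (τ : Fin m → Tm k) (σ : Fin n → Tm m) (M : Tm n) →
              subst τ (subst σ M) ≡ subst (subst τ ∘ σ) M
subst-subst τ σ (var x) = refl
subst-subst τ σ (ƛ M)   =
  cong ƛ_ (trans (subst-subst (exts τ) (exts σ) M) (subst-cong exts-commute M))
  where
  exts-commute : ∀ x → subst (exts τ) (exts σ x) ≡ exts (subst τ ∘ σ) x
  exts-commute zero    = refl
  exts-commute (suc x) = trans (subst-rename (exts τ) suc (σ x))
                               (sym (rename-subst suc τ (σ x)))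
subst-subst τ σ (M · N) = cong₂ _·_ (subst-subst τ σ M) (subst-subst τ σ N)

rename-β : (ρ : Fin n → Fin m) (M : Tm (suc n)) (N : Tm n) →
           rename ρ (M [ N ]₀) ≡ rename (ext ρ) M [ rename ρ N ]₀
rename-β ρ M N = begin
  rename ρ (subst (subst-zero N) M)                    ≡⟨ rename-subst ρ (subst-zero N) M ⟩
  subst (rename ρ ∘ subst-zero N) M                    ≡⟨ subst-cong (λ { zero → refl ; (suc x) → refl }) M ⟩
  subst (subst-zero (rename ρ N) ∘ ext ρ) M            ≡⟨ sym (subst-rename (subst-zero (rename ρ N)) (ext ρ) M) ⟩
  subst (subst-zero (rename ρ N)) (rename (ext ρ) M)   ∎
  where open ≡-Reasoning

extendSubst : (Fin m → Fin k) → (Fin n → Tm m) → Tm k → Fin (suc n) → Tm k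
extendSubst ρ σ N zero    = N
extendSubst ρ σ N (suc x) = rename ρ (σ x)

β-extendSubst : (ρ : Fin m → Fin k) (σ : Fin n → Tm m) (M : Tm (suc n)) (N : Tm k) →
                rename (ext ρ) (subst (exts σ) M) [ N ]₀ ≡ subst (extendSubst ρ σ N) M
β-extendSubst ρ σ M N = begin
  subst (subst-zero N) (rename (ext ρ) (subst (exts σ) M))
    ≡⟨ cong (subst (subst-zero N)) (rename-subst (ext ρ) (exts σ) M) ⟩
  subst (subst-zero N) (subst (rename (ext ρ) ∘ exts σ) M)
    ≡⟨ subst-subst (subst-zero N) (rename (ext ρ) ∘ exts σ) M ⟩
  subst (subst (subst-zero N) ∘ rename (ext ρ) ∘ exts σ) M
    ≡⟨ subst-cong pointwise M ⟩
  subst (extendSubst ρ σ N) M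
    ∎
  where
  open ≡-Reasoning
  pointwise : ∀ x → subst (subst-zero N) (rename (ext ρ) (exts σ x)) ≡ extendSubst ρ σ N x
  pointwise zero    = refl
  pointwise (suc x) = begin
    subst (subst-zero N) (rename (ext ρ) (rename suc (σ x)))
      ≡⟨ cong (subst (subst-zero N)) (rename-rename (ext ρ) suc (σ x)) ⟩
    subst (subst-zero N) (rename (suc ∘ ρ) (σ x))
      ≡⟨ subst-rename (subst-zero N) (suc ∘ ρ) (σ x) ⟩
    subst (var ∘ ρ) (σ x)
      ≡⟨ sym (rename-as-subst ρ (σ x)) ⟩
    rename ρ (σ x)
      ∎

→h-rename : (ρ : Fin n → Fin m) {M M' : Tm n} → M →h M' → rename ρ M →h rename ρ M'
→h-rename ρ (β {M} {N}) = transport (rename ρ ((ƛ M) · N) →h_) (sym (rename-β ρ M N)) β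
→h-rename ρ (app s)     = app (→h-rename ρ s)
→h-rename ρ (lam s)     = lam (→h-rename (ext ρ) s)

→h*-rename : (ρ : Fin n → Fin m) {M M' : Tm n} → M →h* M' → rename ρ M →h* rename ρ M'
→h*-rename ρ done       = done
→h*-rename ρ (step s r) = step (→h-rename ρ s) (→h*-rename ρ r)

→h*-lam : {M M' : Tm (suc n)} → M →h* M' → ƛ M →h* ƛ M'
→h*-lam done       = done
→h*-lam (step s r) = step (lam s) (→h*-lam r)

data Neutral {n : ℕ} : Tm n → Set where
  var : ∀ x → Neutral (var x)
  _·_ : ∀ {M} → Neutral M → ∀ N → Neutral (M · N)

data HeadNormal : ∀ {n} → Tm n → Set where
  neutral : {M : Tm n} → Neutral M → HeadNormal M
  ƛ_      : {M : Tm (suc n)} → HeadNormal M → HeadNormal (ƛ M)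

neutral-rename : (ρ : Fin n → Fin m) {M : Tm n} → Neutral M → Neutral (rename ρ M)
neutral-rename ρ (var x)  = var (ρ x)
neutral-rename ρ (ne · N)  = neutral-rename ρ ne · rename ρ N

headNormal-rename : (ρ : Fin n → Fin m) {M : Tm n} → HeadNormal M → HeadNormal (rename ρ M)
headNormal-rename ρ (neutral ne) = neutral (neutral-rename ρ ne)
headNormal-rename ρ (ƛ h)        = ƛ headNormal-rename (ext ρ) h

neutral-stuck : {M M' : Tm n} → Neutral M → ¬ (M →h M')
neutral-stuck (var x)         ()
neutral-stuck (var x · N)     ()
neutral-stuck ((ne · N') · N) (app s) = neutral-stuck (ne · N') s

headNormal-stuck : {M M' : Tm n} → HeadNormal M → ¬ (M →h M')
headNormal-stuck (neutral ne) s       = neutral-stuck ne s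
headNormal-stuck (ƛ h)        (lam s) = headNormal-stuck h s

HeadNormalising : Tm n → Set
HeadNormalising M = Σ[ N ∈ _ ] (M →h* N × HeadNormal N)

headNormalising-terminates : {M : Tm n} → HeadNormalising M → HeadTerminates M
headNormalising-terminates (N , r , h) = N , r , λ _ → headNormal-stuck h

neutral-headNormalising : {M : Tm n} → Neutral M → HeadNormalising M
neutral-headNormalising ne = _ , done , neutral ne

headNormalising-expand : {M M' : Tm n} → M →h M' → HeadNormalising M' → HeadNormalising M
headNormalising-expand s (N , r , h) = N , step s r , h

headNormalising-rename : (ρ : Fin n → Fin m) {M : Tm n} →
                         HeadNormalising M → HeadNormalising (rename ρ M)
headNormalising-rename ρ (N , r , h) = rename ρ N , →h*-rename ρ r , headNormal-rename ρ h

headNormalising-lam : {M : Tm (suc n)} → HeadNormalising M → HeadNormalising (ƛ M)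
headNormalising-lam (N , r , h) = ƛ N , →h*-lam r , ƛ h

module Realizability (A : Category) where
  open Model A

  -- ⟪ a ⟫ M : M realizes the type a; ⟪ as ⟫* M : M realizes every type of
  -- the list as.  Arrow realizers are Kripke-quantified over renamings, so
  -- that they remain realizers under binders.
  mutual
    ⟪_⟫ : Ty → Tm m → Set
    ⟪ atom o ⟫       M = HeadNormalising M
    ⟪_⟫ {m} (as ⇒ a) M = HeadNormalising M ×
      (∀ {k} (ρ : Fin m → Fin k) (N : Tm k) → ⟪ as ⟫* N → ⟪ a ⟫ (rename ρ M · N))

    ⟪_⟫* : List Ty → Tm m → Set
    ⟪ []     ⟫* N = ⊤
    ⟪ a ∷ as ⟫* N = ⟪ a ⟫ N × ⟪ as ⟫* N

  ⟪⟫*-lookup : ∀ as {N : Tm m} → ⟪ as ⟫* N → (i : Fin (length as)) → ⟪ lookup as i ⟫ N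
  ⟪⟫*-lookup (a ∷ as) (r , rs) zero    = r
  ⟪⟫*-lookup (a ∷ as) (r , rs) (suc i) = ⟪⟫*-lookup as rs i

  ⟪⟫*-tabulate : ∀ as {N : Tm m} → ((i : Fin (length as)) → ⟪ lookup as i ⟫ N) → ⟪ as ⟫* N
  ⟪⟫*-tabulate []       f = tt
  ⟪⟫*-tabulate (a ∷ as) f = f zero , ⟪⟫*-tabulate as (f ∘ suc)

  ⟪⟫*-split : ∀ as {bs} {N : Tm m} → ⟪ as ++ bs ⟫* N → ⟪ as ⟫* N × ⟪ bs ⟫* N
  ⟪⟫*-split []       rs       = tt , rs
  ⟪⟫*-split (a ∷ as) (r , rs) = let (ras , rbs) = ⟪⟫*-split as rs in (r , ras) , rbs

  realizer-headNormalising : ∀ a {M : Tm m} → ⟪ a ⟫ M → HeadNormalising M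
  realizer-headNormalising (atom o) r = r
  realizer-headNormalising (as ⇒ a) r = proj₁ r

  mutual
    neutral-realizer : ∀ a {M : Tm m} → Neutral M → ⟪ a ⟫ M
    neutral-realizer (atom o) ne = neutral-headNormalising ne
    neutral-realizer (as ⇒ a) ne =
      neutral-headNormalising ne , λ ρ N _ → neutral-realizer a (neutral-rename ρ ne · N)

    neutral-realizer* : ∀ as {M : Tm m} → Neutral M → ⟪ as ⟫* M
    neutral-realizer* []       ne = tt
    neutral-realizer* (a ∷ as) ne = neutral-realizer a ne , neutral-realizer* as ne

  realizer-expand : ∀ a {M₁ M₂ M' : Tm m} → M₁ · M₂ →h M' → ⟪ a ⟫ M' → ⟪ a ⟫ (M₁ · M₂)
  realizer-expand (atom o) s r       = headNormalising-expand s r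
  realizer-expand (as ⇒ a) s (h , f) =
    headNormalising-expand s h , λ ρ N rs → realizer-expand a (app (→h-rename ρ s)) (f ρ N rs)

  mutual
    realizer-rename : ∀ a (ρ : Fin m → Fin k) {M : Tm m} → ⟪ a ⟫ M → ⟪ a ⟫ (rename ρ M)
    realizer-rename (atom o) ρ r             = headNormalising-rename ρ r
    realizer-rename (as ⇒ a) ρ {M} (h , f) =
      headNormalising-rename ρ h ,
      λ ρ' N rs → transport (λ P → ⟪ a ⟫ (P · N)) (sym (rename-rename ρ' ρ M)) (f (ρ' ∘ ρ) N rs)

    realizer-rename* : ∀ as (ρ : Fin m → Fin k) {M : Tm m} → ⟪ as ⟫* M → ⟪ as ⟫* (rename ρ M)
    realizer-rename* []       ρ tt       = tt
    realizer-rename* (a ∷ as) ρ (r , rs) = realizer-rename a ρ r , realizer-rename* as ρ rs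

  mutual
    DHom-realizer : ∀ {a b} → DHom a b → {M : Tm m} → ⟪ a ⟫ M → ⟪ b ⟫ M
    DHom-realizer (atomH h)    r       = r
    DHom-realizer (arrH sh d) (h , f) = h , λ ρ N rs → DHom-realizer d (f ρ N (SHom-realizer sh rs))

    SHom-realizer : ∀ {as bs} → SHom as bs → {M : Tm m} → ⟪ as ⟫* M → ⟪ bs ⟫* M
    SHom-realizer {as = as} {bs} (shom α f) {M} rs = ⟪⟫*-tabulate bs realize
      where
      realize : (j : Fin (length bs)) → ⟪ lookup bs j ⟫ M
      realize j with Bijection.strictlySurjective α j
      ... | i , αi≡j = transport (λ j' → ⟪ lookup bs j' ⟫ M) αi≡j
                                 (DHom-realizer (f i) (⟪⟫*-lookup as rs i))

  _⊩_ : (Fin n → Tm m) → Ctx n → Set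
  σ ⊩ Δ = ∀ x → ⟪ V.lookup Δ x ⟫* (σ x)

  ⊩-SDⁿ : {σ : Fin n → Tm m} {Δ Γ : Ctx n} → SDⁿ Δ Γ → σ ⊩ Δ → σ ⊩ Γ
  ⊩-SDⁿ h σ⊩Δ x = SHom-realizer (Pointwise.lookup h x) (σ⊩Δ x)

  ⊩-⊗ : {σ : Fin n → Tm m} (Γ₀ Γ₁ : Ctx n) → σ ⊩ (Γ₀ ⊗ Γ₁) → σ ⊩ Γ₀ × σ ⊩ Γ₁
  ⊩-⊗ {σ = σ} Γ₀ Γ₁ σ⊩ = proj₁ ∘ split , proj₂ ∘ split
    where
    split : ∀ x → ⟪ V.lookup Γ₀ x ⟫* (σ x) × ⟪ V.lookup Γ₁ x ⟫* (σ x)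
    split x = ⟪⟫*-split (V.lookup Γ₀ x)
                    (transport (λ Γ → ⟪ Γ ⟫* _) (lookup-zipWith _++_ x Γ₀ Γ₁) (σ⊩ x))

  ⊩-⨂ : {σ : Fin n → Tm m} (Γ₀ : Ctx n) (Γs : Vec (Ctx n) k) →
        σ ⊩ ⨂ Γ₀ Γs → σ ⊩ Γ₀ × ((i : Fin k) → σ ⊩ V.lookup Γs i)
  ⊩-⨂ {n = n} {σ = σ} Γ₀ Γs σ⊩ =
    let (σ⊩Γ₀ , σ⊩rest) = ⊩-⊗ Γ₀ _ σ⊩ in σ⊩Γ₀ , ⊩-fold Γs σ⊩rest
    where
    ⊩-fold : ∀ {k} (Γs : Vec (Ctx n) k) → σ ⊩ foldr _ _⊗_ ε Γs → (i : Fin k) → σ ⊩ V.lookup Γs i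
    ⊩-fold (Γ ∷ Γs) σ⊩ zero    = proj₁ (⊩-⊗ Γ _ σ⊩)
    ⊩-fold (Γ ∷ Γs) σ⊩ (suc i) = ⊩-fold Γs (proj₂ (⊩-⊗ Γ _ σ⊩)) i

  ⊩-single : {σ : Fin n → Tm m} (i : Fin n) {a : Ty} → σ ⊩ single i a → ⟪ a ⟫ (σ i)
  ⊩-single i {a} σ⊩ = proj₁ (transport (λ Γ → ⟪ Γ ⟫* _) (lookup∘update i ε [ a ]) (σ⊩ i))

  ⊩-extend : {σ : Fin n → Tm m} {Δ : Ctx n} (ρ : Fin m → Fin k) {as : List Ty} {N : Tm k} →
             σ ⊩ Δ → ⟪ as ⟫* N → extendSubst ρ σ N ⊩ (Δ ⊕ as)
  ⊩-extend ρ σ⊩ rs zero    = rs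
  ⊩-extend ρ σ⊩ rs (suc x) = realizer-rename* _ ρ (σ⊩ x)

  ⊩-var : (Δ : Ctx n) → var ⊩ Δ
  ⊩-var Δ x = neutral-realizer* (V.lookup Δ x) (var x)

  adequacy : (M : Tm n) {Δ : Ctx n} {a : Ty} → ⟦ M ⟧ Δ a →
             {σ : Fin n → Tm m} → σ ⊩ Δ → ⟪ a ⟫ (subst σ M)
  adequacy (var i)                 d σ⊩ = ⊩-single i (⊩-SDⁿ d σ⊩)
  adequacy (ƛ M) {a = atom o}      () σ⊩
  adequacy (ƛ M) {Δ} {as ⇒ b} d {σ} σ⊩ =
    headNormalising-lam (realizer-headNormalising b (adequacy M d exts⊩)) ,
    λ ρ N rs → realizer-expand b β
      (transport ⟪ b ⟫ (sym (β-extendSubst ρ σ M N)) (adequacy M d (⊩-extend ρ σ⊩ rs)))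
    where
    -- the body is realized under exts σ, which agrees pointwise with
    -- extendSubst suc σ (var zero)
    extended⊩ : extendSubst suc σ (var zero) ⊩ (Δ ⊕ as)
    extended⊩ = ⊩-extend suc σ⊩ (neutral-realizer* as (var zero))
    exts⊩ : exts σ ⊩ (Δ ⊕ as)
    exts⊩ zero    = extended⊩ zero
    exts⊩ (suc x) = extended⊩ (suc x)
  adequacy (M · N) {Δ} {a} (as , Γ₀ , Γs , dM , dN , h) {σ} σ⊩ =
    transport (λ P → ⟪ a ⟫ (P · subst σ N)) (rename-id (subst σ M))
      (proj₂ (adequacy M dM σ⊩Γ₀) id (subst σ N)
             (⟪⟫*-tabulate as (λ i → adequacy N (dN i) (σ⊩Γs i))))
    where
    σ⊩parts : σ ⊩ Γ₀ × ((i : Fin (length as)) → σ ⊩ V.lookup Γs i)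
    σ⊩parts = ⊩-⨂ Γ₀ Γs (⊩-SDⁿ h σ⊩)
    σ⊩Γ₀ : σ ⊩ Γ₀
    σ⊩Γ₀ = proj₁ σ⊩parts
    σ⊩Γs : (i : Fin (length as)) → σ ⊩ V.lookup Γs i
    σ⊩Γs = proj₂ σ⊩parts

theorem7 : (A : Category) {n : ℕ} (M : Tm n) →
           Model.NonEmpty A M → HeadTerminates M
theorem7 A M (Δ , a , d) =
  headNormalising-terminates
    (transport HeadNormalising (subst-var M)
      (realizer-headNormalising a (adequacy M d (⊩-var Δ))))
  where open Realizability A
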